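{- Let $\theta$ be a type of shape $S$, $|S|=n$. For every filling sequence $L=[\mathfrak c_1,\dots,\mathfrak c_n]$ of $\theta$, the tableau $T_L$ defined by $t_{\mathfrak c_i}=i$ has type $\theta$, and the map $L\mapsto T_L$ is a bijection from the set of filling sequences of $\theta$ onto $\mathrm{Tab}(\theta)$.
   Context: A diagram is a finite subset $S\subset\mathbb N_{>0}^2$; $(a,b)$ is the box in row $a$, column $b$. Arm $A_S(a,b)=\{(a,k)\in S:k>b\}$, leg $L_S(a,b)=\{(k,b)\in S:k\ge a\}$, hook $H_S=A_S\cup L_S$, $h_S=|H_S|$. A tableau of shape $S$ is a bijection $t:S\to\{1,\dots,n\}$. A type of shape $S$ is a map $\theta:S\to\mathbb Z$ with $0\le\theta\le h_S-1$. The type of a tableau $T$ is $\theta(\mathfrak c)=|\{\mathfrak d\in H_S(\mathfrak c):t_{\mathfrak d}<t_{\mathfrak c}\}|$; $\mathrm{Tab}(\theta)$ is the set of tableaux of shape $S$ of type $\theta$. A box $\mathfrak c$ is erasable in a type $\theta$ of shape $S$ if $\theta(\mathfrak c)=0$ and $\theta(\mathfrak d)\neq0$ for all $\mathfrak d\in S\setminus\{\mathfrak c\}$ with $\mathfrak c\in H_S(\mathfrak d)$. A sequence $L=[\mathfrak c_1,\dots,\mathfrak c_n]$ of pairwise distinct boxes of $S$ is a filling sequence of $\theta$ if, setting $S_1=S$, $\theta_1=\theta$, for each $i$ the box $\mathfrak c_i$ is erasable in the type $\theta_i$ of shape $S_i$, where $S_{i+1}=S_i\setminus\{\mathfrak c_i\}$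 and $\theta_{i+1}(\mathfrak d)=\theta_i(\mathfrak d)-1$ if $\mathfrak c_i\in H_{S_i}(\mathfrak d)$ and $\theta_{i+1}(\mathfrak d)=\theta_i(\mathfrak d)$ otherwise ($\mathfrak d\in S_{i+1}$). -}

module Defs where

open import Data.Nat as ℕ using (ℕ; zero; suc; _<_; _≤_; _<ᵇ_; _≤ᵇ_; _≡ᵇ_)
open import Data.Integer as ℤ using (ℤ; +_)
open import Data.Bool using (Bool; true; false; _∧_; _∨_; if_then_else_; not)
open import Data.Product using (_×_; _,_; proj₁; proj₂; Σ; ∃-syntax)
open import Data.List using (List; []; _∷_; length)
open import Data.List.Membership.Propositional using (_∈_)
open import Data.List.Relation.Unary.All using (All)
open import Data.List.Relation.Unary.Unique.Propositional using (Unique)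
open import Relation.Binary.PropositionalEquality using (_≡_; _≢_)

boolFilter : {A : Set} → (A → Bool) → List A → List A
boolFilter p []       = []
boolFilter p (x ∷ xs) = if p x then x ∷ boolFilter p xs else boolFilter p xs

-- A box (a , b) : row a, column b.
Box : Set
Box = ℕ × ℕ

_==_ : Box → Box → Bool
(a , b) == (a' , b') = (a ≡ᵇ a') ∧ (b ≡ᵇ b')

IsDiagram : List Box → Set
IsDiagram S = Unique S × All (λ c → 1 ≤ proj₁ c × 1 ≤ proj₂ c) S

-- inHook c d = true iff the box d lies in the arm or leg of c
-- (coordinatewise; H_S(c) is the set of such d belonging to S). Leg: same column, row ≥ row of c (contains c).
inHook : Box → Box → Bool
inHook (a , b) (k , l) = ((k ≡ᵇ a) ∧ (b <ᵇ l)) ∨ ((l ≡ᵇ b) ∧ (a ≤ᵇ k))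

hook : List Box → Box → List Box
hook S c = boolFilter (inHook c) S

hookLen : List Box → Box → ℕ
hookLen S c = length (hook S c)

-- A type of shape S: θ : S → ℤ with 0 ≤ θ ≤ h_S - 1 (values off S are irrelevant).
IsType : List Box → (Box → ℤ) → Set
IsType S θ = ∀ c → c ∈ S → (+ 0 ℤ.≤ θ c) × (θ c ℤ.< + hookLen S c)

-- A tableau of shape S: a bijection t : S → {1,…,n}, n = |S|
-- (represented by a function on boxes; only its values on S matter).
IsTableau : List Box → (Box → ℕ) → Set
IsTableau S t =
  (∀ c → c ∈ S → 1 ≤ t c × t c ≤ length S)
  × (∀ c d → c ∈ S → d ∈ S → t c ≡ t d → c ≡ d)
  × (∀ i → 1 ≤ i → i ≤ length S → ∃[ c ] (c ∈ S × t c ≡ i))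

typeOf : List Box → (Box → ℕ) → Box → ℤ
typeOf S t c = + length (boolFilter (λ d → t d <ᵇ t c) (hook S c))

HasType : List Box → (Box → ℤ) → (Box → ℕ) → Set
HasType S θ t = ∀ c → c ∈ S → typeOf S t c ≡ θ c

Erasable : List Box → (Box → ℤ) → Box → Set
Erasable S θ c =
  c ∈ S × θ c ≡ + 0
  × (∀ d → d ∈ S → d ≢ c → inHook d c ≡ true → θ d ≢ + 0)

removeBox : Box → List Box → List Box
removeBox c S = boolFilter (λ d → not (d == c)) S

eraseType : Box → (Box → ℤ) → Box → ℤ
eraseType c θ d = if inHook d c then θ d ℤ.- + 1 else θ d

-- L is a filling sequence of the type θ of shape S
-- (the sequence must exhaust S; distinctness follows since each c_i is removed).
IsFilling : List Box → (Box → ℤ) → List Box → Set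
IsFilling S θ []      = S ≡ []
IsFilling S θ (c ∷ L) = Erasable S θ c × IsFilling (removeBox c S) (eraseType c θ) L

tabOf : List Box → Box → ℕ
tabOf []      c = 0
tabOf (d ∷ L) c = if c == d then 1 else suc (tabOf L c)

-- Everything rests on one observation about a tableau t of shape S whose box c carries the
-- label 1, and the tableau t′ of shape S \ {c} obtained by lowering all other labels by one:
-- c has type 0 in t, and for every other box d the type of d in t exceeds the type of d in t′
-- by one exactly when c lies in the hook of d.  So the type of t′ is the type of t with c
-- erased, and c is erasable.  Reading T_L as "c₁ gets 1, then T_{[c₂,…,cₙ]} shifted up"
-- gives the first two claims by induction on L; conversely, peeling off the box labelled 1
-- turns any tableau of type θ into a filling sequence.
module Submission where

open import Defs
open import Data.Nat using (ℕ; zero; suc; pred; _+_; _≤_; z≤n; s≤s; s≤s⁻¹; _<ᵇ_; >-nonZero)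
open import Data.Nat.Properties using (_≟_; suc-injective; suc-pred; ≤-refl; <⇒≢; +-commutativeSemigroup)
open import Algebra.Properties.CommutativeSemigroup +-commutativeSemigroup using (x∙yz≈y∙xz)
open import Data.Integer as ℤ using (ℤ; +_)
open import Data.Bool using (Bool; true; false; _∧_; not; if_then_else_)
open import Data.Bool.Properties using (∧-zeroʳ; ∧-identityʳ)
open import Data.Product using (_×_; _,_; proj₁; proj₂; uncurry; ∃-syntax)
open import Function using (_∘′_)
open import Data.Product.Properties using (,-injective)
open import Data.Sum using (_⊎_; inj₁; inj₂)
open import Data.List using (List; []; _∷_; length; filter)
open import Data.List.Properties using (filter-accept; filter-reject)
open import Data.List.Membership.Propositional using (_∈_)
open import Data.List.Membership.Propositional.Properties using (∈-filter⁺; ∈-filter⁻)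
open import Data.List.Relation.Unary.Any using (here; there)
open import Data.List.Relation.Unary.All using (All; []; _∷_)
import Data.List.Relation.Unary.All as All
open import Data.List.Relation.Unary.AllPairs using (_∷_)
open import Data.List.Relation.Unary.Unique.Propositional using (Unique)
import Data.List.Relation.Unary.Unique.Propositional.Properties as Unique
open import Relation.Nullary using (does; yes; no; ¬?; contradiction)
open import Relation.Nullary.Decidable using (map′; _×-dec_; dec-true; dec-false)
open import Relation.Unary using (Decidable)
open import Relation.Binary.Definitions using (DecidableEquality)
open import Relation.Binary.PropositionalEquality

_≟ᵇ_ : DecidableEquality Box
(a , b) ≟ᵇ (a′ , b′) = map′ (uncurry (cong₂ _,_)) ,-injective (a ≟ a′ ×-dec b ≟ b′)

boolFilter-does : ∀ {A : Set} {P : A → Set} (P? : Decidable P) xs →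
                  boolFilter (λ x → does (P? x)) xs ≡ filter P? xs
boolFilter-does P? []       = refl
boolFilter-does P? (x ∷ xs) with does (P? x)
... | true  = cong (x ∷_) (boolFilter-does P? xs)
... | false = boolFilter-does P? xs

boolFilter-true : (xs : List Box) → boolFilter (λ _ → true) xs ≡ xs
boolFilter-true []       = refl
boolFilter-true (x ∷ xs) = cong (x ∷_) (boolFilter-true xs)

boolFilter-boolFilter : ∀ (p q : Box → Bool) xs →
                        boolFilter p (boolFilter q xs) ≡ boolFilter (λ e → q e ∧ p e) xs
boolFilter-boolFilter p q []       = refl
boolFilter-boolFilter p q (x ∷ xs) with q x
... | false = boolFilter-boolFilter p q xs
... | true with p x
...   | true  = cong (x ∷_) (boolFilter-boolFilter p q xs)
...   | false = boolFilter-boolFilter p q xs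

-- d == c is definitionally does (d ≟ᵇ c), so removeBox is a library filter.
removeBox-filter : ∀ c S → removeBox c S ≡ filter (λ d → ¬? (d ≟ᵇ c)) S
removeBox-filter c = boolFilter-does (λ d → ¬? (d ≟ᵇ c))

∈-removeBox⁺ : ∀ {c d} S → d ∈ S → d ≢ c → d ∈ removeBox c S
∈-removeBox⁺ {c} S d∈S d≢c =
  subst (_ ∈_) (sym (removeBox-filter c S)) (∈-filter⁺ (λ e → ¬? (e ≟ᵇ c)) d∈S d≢c)

∈-removeBox⁻ : ∀ {c d} S → d ∈ removeBox c S → d ∈ S × d ≢ c
∈-removeBox⁻ {c} S d∈S′ = ∈-filter⁻ (λ e → ¬? (e ≟ᵇ c)) (subst (_ ∈_) (removeBox-filter c S) d∈S′)

∈-removeBox-split : ∀ {c d} S → d ∈ S → d ≡ c ⊎ d ∈ removeBox c S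
∈-removeBox-split {c} {d} S d∈S with d ≟ᵇ c
... | yes d≡c = inj₁ d≡c
... | no d≢c  = inj₂ (∈-removeBox⁺ S d∈S d≢c)

removeBox-unique : ∀ {S} c → Unique S → Unique (removeBox c S)
removeBox-unique {S} c u = subst Unique (sym (removeBox-filter c S)) (Unique.filter⁺ (λ e → ¬? (e ≟ᵇ c)) u)

removeBox-head : ∀ c S → removeBox c (c ∷ S) ≡ removeBox c S
removeBox-head c S = begin
  removeBox c (c ∷ S)                  ≡⟨ removeBox-filter c (c ∷ S) ⟩
  filter (λ e → ¬? (e ≟ᵇ c)) (c ∷ S)   ≡⟨ filter-reject (λ e → ¬? (e ≟ᵇ c)) (λ c≢c → c≢c refl) ⟩
  filter (λ e → ¬? (e ≟ᵇ c)) S         ≡⟨ removeBox-filter c S ⟨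
  removeBox c S                        ∎
  where open ≡-Reasoning

removeBox-cons : ∀ {c d} S → d ≢ c → removeBox c (d ∷ S) ≡ d ∷ removeBox c S
removeBox-cons {c} {d} S d≢c = begin
  removeBox c (d ∷ S)                      ≡⟨ removeBox-filter c (d ∷ S) ⟩
  filter (λ e → ¬? (e ≟ᵇ c)) (d ∷ S)       ≡⟨ filter-accept (λ e → ¬? (e ≟ᵇ c)) d≢c ⟩
  d ∷ filter (λ e → ¬? (e ≟ᵇ c)) S         ≡⟨ cong (d ∷_) (removeBox-filter c S) ⟨
  d ∷ removeBox c S                        ∎
  where open ≡-Reasoning

removeBox-∉ : ∀ {c} S → All (c ≢_) S → removeBox c S ≡ S
removeBox-∉ []      []            = refl
removeBox-∉ (d ∷ S) (c≢d ∷ c∉S) =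
  trans (removeBox-cons S (≢-sym c≢d)) (cong (d ∷_) (removeBox-∉ S c∉S))

count : (Box → Bool) → List Box → ℕ
count p xs = length (boolFilter p xs)

indicator : Bool → ℕ
indicator true  = 1
indicator false = 0

count-∷ : ∀ p x xs → count p (x ∷ xs) ≡ indicator (p x) + count p xs
count-∷ p x xs with p x
... | true  = refl
... | false = refl

count-cong : ∀ (p q : Box → Bool) xs → (∀ e → e ∈ xs → p e ≡ q e) → count p xs ≡ count q xs
count-cong p q []       p≗q = refl
count-cong p q (x ∷ xs) p≗q = begin
  count p (x ∷ xs)              ≡⟨ count-∷ p x xs ⟩
  indicator (p x) + count p xs  ≡⟨ cong₂ (λ b n → indicator b + n) (p≗q x (here refl))
                                         (count-cong p q xs (λ e e∈xs → p≗q e (there e∈xs))) ⟩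
  indicator (q x) + count q xs  ≡⟨ count-∷ q x xs ⟨
  count q (x ∷ xs)              ∎
  where open ≡-Reasoning

count-none : ∀ (p : Box → Bool) xs → (∀ e → e ∈ xs → p e ≡ false) → count p xs ≡ 0
count-none p []       none = refl
count-none p (x ∷ xs) none = begin
  count p (x ∷ xs)              ≡⟨ count-∷ p x xs ⟩
  indicator (p x) + count p xs  ≡⟨ cong₂ (λ b n → indicator b + n) (none x (here refl))
                                         (count-none p xs (λ e e∈xs → none e (there e∈xs))) ⟩
  0                             ∎
  where open ≡-Reasoning

count-removeBox : ∀ p {c} S → Unique S → c ∈ S →
                  count p S ≡ indicator (p c) + count p (removeBox c S)
count-removeBox p (c ∷ S) (c∉S ∷ _) (here refl) = begin
  count p (c ∷ S)                                 ≡⟨ count-∷ p c S ⟩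
  indicator (p c) + count p S                     ≡⟨ cong (λ xs → indicator (p c) + count p xs) (removeBox-∉ S c∉S) ⟨
  indicator (p c) + count p (removeBox c S)       ≡⟨ cong (λ xs → indicator (p c) + count p xs) (removeBox-head c S) ⟨
  indicator (p c) + count p (removeBox c (c ∷ S)) ∎
  where open ≡-Reasoning
count-removeBox p {c} (d ∷ S) (d∉S ∷ u) (there c∈S) = begin
  count p (d ∷ S)
    ≡⟨ count-∷ p d S ⟩
  indicator (p d) + count p S
    ≡⟨ cong (_+_ (indicator (p d))) (count-removeBox p S u c∈S) ⟩
  indicator (p d) + (indicator (p c) + count p (removeBox c S))
    ≡⟨ x∙yz≈y∙xz (indicator (p d)) (indicator (p c)) _ ⟩
  indicator (p c) + (indicator (p d) + count p (removeBox c S))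
    ≡⟨ cong (_+_ (indicator (p c))) (count-∷ p d (removeBox c S)) ⟨
  indicator (p c) + count p (d ∷ removeBox c S)
    ≡⟨ cong (λ xs → indicator (p c) + count p xs) (removeBox-cons S d≢c) ⟨
  indicator (p c) + count p (removeBox c (d ∷ S))
    ∎
  where
  open ≡-Reasoning
  d≢c : d ≢ c
  d≢c = All.lookup d∉S c∈S

length-removeBox : ∀ {c} S → Unique S → c ∈ S → length S ≡ suc (length (removeBox c S))
length-removeBox {c} S u c∈S = begin
  length S                                 ≡⟨ cong length (boolFilter-true S) ⟨
  count (λ _ → true) S                     ≡⟨ count-removeBox (λ _ → true) S u c∈S ⟩
  suc (count (λ _ → true) (removeBox c S)) ≡⟨ cong (suc ∘′ length) (boolFilter-true (removeBox c S)) ⟩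
  suc (length (removeBox c S))             ∎
  where open ≡-Reasoning

smallerInHook : (Box → ℕ) → Box → Box → Bool
smallerInHook t d e = inHook d e ∧ (t e <ᵇ t d)

typeOf-count : ∀ S t d → typeOf S t d ≡ + count (smallerInHook t d) S
typeOf-count S t d = cong (+_ ∘′ length) (boolFilter-boolFilter (λ e → t e <ᵇ t d) (inHook d) S)

≤⇒≮ᵇ : ∀ {m n} → m ≤ n → (n <ᵇ m) ≡ false
≤⇒≮ᵇ z≤n     = refl
≤⇒≮ᵇ (s≤s p) = ≤⇒≮ᵇ p

typeOf-minimum : ∀ S t c → (∀ e → e ∈ S → t c ≤ t e) → typeOf S t c ≡ + 0
typeOf-minimum S t c minimum = trans (typeOf-count S t c) (cong +_ (count-none _ S none))
  where
  none : ∀ e → e ∈ S → smallerInHook t c e ≡ false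
  none e e∈S = trans (cong (inHook c e ∧_) (≤⇒≮ᵇ (minimum e e∈S))) (∧-zeroʳ (inHook c e))

record Extends (S : List Box) (c : Box) (t t′ : Box → ℕ) : Set where
  field
    at-c  : t c ≡ 1
    shift : ∀ d → d ∈ removeBox c S → t d ≡ suc (t′ d)
open Extends

extends-minimum : ∀ {S c t t′} → Extends S c t t′ → ∀ e → e ∈ S → t c ≤ t e
extends-minimum {S} {c} {t} {t′} ext e e∈S with ∈-removeBox-split {c} S e∈S
... | inj₁ refl = ≤-refl
... | inj₂ e∈S′ rewrite at-c ext | shift ext e e∈S′ = s≤s z≤n

typeOf-extends : ∀ {S c t t′} → Unique S → c ∈ S → Extends S c t t′ →
                 (∀ e → e ∈ removeBox c S → 1 ≤ t′ e) → ∀ d → d ∈ removeBox c S →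
                 typeOf S t d ≡ + indicator (inHook d c) ℤ.+ typeOf (removeBox c S) t′ d
typeOf-extends {S} {c} {t} {t′} u c∈S ext positive d d∈S′ = begin
  typeOf S t d
    ≡⟨ typeOf-count S t d ⟩
  + count (smallerInHook t d) S
    ≡⟨ cong +_ (count-removeBox (smallerInHook t d) S u c∈S) ⟩
  + (indicator (smallerInHook t d c) + count (smallerInHook t d) S′)
    ≡⟨ cong₂ (λ b n → + (indicator b + n)) c-counted (count-cong _ _ S′ shifted) ⟩
  + (indicator (inHook d c) + count (smallerInHook t′ d) S′)
    ≡⟨ cong (ℤ._+_ (+ indicator (inHook d c))) (typeOf-count S′ t′ d) ⟨
  + indicator (inHook d c) ℤ.+ typeOf S′ t′ d
    ∎
  where
  open ≡-Reasoning
  S′ = removeBox c S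
  c-counted : smallerInHook t d c ≡ inHook d c
  c-counted rewrite at-c ext | shift ext d d∈S′ with t′ d | positive d d∈S′
  ... | suc _ | _ = ∧-identityʳ (inHook d c)
  shifted : ∀ e → e ∈ S′ → smallerInHook t d e ≡ smallerInHook t′ d e
  shifted e e∈S′ rewrite shift ext e e∈S′ | shift ext d d∈S′ = refl

decrement-if : ∀ b k {x} → x ≡ + indicator b ℤ.+ + k → (if b then x ℤ.- + 1 else x) ≡ + k
decrement-if true  k refl = refl
decrement-if false k refl = refl

decrement-if⁻¹ : ∀ b k x → (if b then x ℤ.- + 1 else x) ≡ + k → x ≡ + indicator b ℤ.+ + k
decrement-if⁻¹ true  k (+ suc m) refl = refl
decrement-if⁻¹ false k x         refl = refl

module _ {S c t t′} (u : Unique S) (c∈S : c ∈ S) (ext : Extends S c t t′)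
         (positive : ∀ e → e ∈ removeBox c S → 1 ≤ t′ e) where

  eraseType-typeOf : ∀ d → d ∈ removeBox c S → eraseType c (typeOf S t) d ≡ typeOf (removeBox c S) t′ d
  eraseType-typeOf d d∈S′ = decrement-if (inHook d c) _ (typeOf-extends u c∈S ext positive d d∈S′)

  typeOf-hook-nonzero : ∀ d → d ∈ removeBox c S → inHook d c ≡ true → typeOf S t d ≢ + 0
  typeOf-hook-nonzero d d∈S′ c∈H[d] rewrite typeOf-extends u c∈S ext positive d d∈S′ | c∈H[d] = λ ()

  hasType-restrict : ∀ {θ} → HasType S θ t → HasType (removeBox c S) (eraseType c θ) t′
  hasType-restrict {θ} ty d d∈S′ = begin
    typeOf (removeBox c S) t′ d  ≡⟨ eraseType-typeOf d d∈S′ ⟨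
    eraseType c (typeOf S t) d   ≡⟨ cong (λ x → if inHook d c then x ℤ.- + 1 else x) (ty d (proj₁ (∈-removeBox⁻ S d∈S′))) ⟩
    eraseType c θ d              ∎
    where open ≡-Reasoning

  hasType-extend : ∀ {θ} → θ c ≡ + 0 → HasType (removeBox c S) (eraseType c θ) t′ → HasType S θ t
  hasType-extend {θ} θc≡0 ty′ d d∈S with ∈-removeBox-split {c} S d∈S
  ... | inj₁ refl = trans (typeOf-minimum S t c (extends-minimum ext)) (sym θc≡0)
  ... | inj₂ d∈S′ = begin
    typeOf S t d                                ≡⟨ typeOf-extends u c∈S ext positive d d∈S′ ⟩
    + indicator (inHook d c) ℤ.+ typeOf S′ t′ d ≡⟨ decrement-if⁻¹ (inHook d c) _ (θ d) (sym (ty′ d d∈S′)) ⟨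
    θ d                                         ∎
    where
    open ≡-Reasoning
    S′ = removeBox c S

module _ {S c t t′} (u : Unique S) (c∈S : c ∈ S) (ext : Extends S c t t′) where

  private
    S′ = removeBox c S
    |S|≡1+|S′| = length-removeBox S u c∈S

  isTableau-extend : IsTableau S′ t′ → IsTableau S t
  isTableau-extend (range′ , injective′ , onto′) = range , injective , onto
    where
    range : ∀ d → d ∈ S → 1 ≤ t d × t d ≤ length S
    range d d∈S with ∈-removeBox-split {c} S d∈S
    ... | inj₁ refl rewrite at-c ext | |S|≡1+|S′| = s≤s z≤n , s≤s z≤n
    ... | inj₂ d∈S′ rewrite shift ext d d∈S′ | |S|≡1+|S′| = s≤s z≤n , s≤s (proj₂ (range′ d d∈S′))

    ≢-label-c : ∀ d → d ∈ S′ → t d ≢ t c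
    ≢-label-c d d∈S′ td≡tc with t′ d | range′ d d∈S′ | trans (sym (shift ext d d∈S′)) (trans td≡tc (at-c ext))
    ... | suc _ | _ | ()

    injective : ∀ d e → d ∈ S → e ∈ S → t d ≡ t e → d ≡ e
    injective d e d∈S e∈S td≡te with ∈-removeBox-split {c} S d∈S | ∈-removeBox-split {c} S e∈S
    ... | inj₁ refl  | inj₁ refl  = refl
    ... | inj₁ refl  | inj₂ e∈S′ = contradiction (sym td≡te) (≢-label-c e e∈S′)
    ... | inj₂ d∈S′ | inj₁ refl  = contradiction td≡te (≢-label-c d d∈S′)
    ... | inj₂ d∈S′ | inj₂ e∈S′ = injective′ d e d∈S′ e∈S′
      (suc-injective (trans (sym (shift ext d d∈S′)) (trans td≡te (shift ext e e∈S′))))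

    onto : ∀ i → 1 ≤ i → i ≤ length S → ∃[ d ] (d ∈ S × t d ≡ i)
    onto (suc zero)    _ _    = c , c∈S , at-c ext
    onto (suc (suc j)) _ i≤|S| with onto′ (suc j) (s≤s z≤n) (s≤s⁻¹ (subst (suc (suc j) ≤_) |S|≡1+|S′| i≤|S|))
    ... | d , d∈S′ , t′d≡1+j = d , proj₁ (∈-removeBox⁻ S d∈S′) , trans (shift ext d d∈S′) (cong suc t′d≡1+j)

  isTableau-restrict : IsTableau S t → IsTableau S′ t′
  isTableau-restrict (range , injective , onto) = range′ , injective′ , onto′
    where
    d≢c⇒t′d≢0 : ∀ d → d ∈ S′ → t′ d ≢ 0
    d≢c⇒t′d≢0 d d∈S′ t′d≡0 = let (d∈S , d≢c) = ∈-removeBox⁻ S d∈S′ in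
      d≢c (injective d c d∈S c∈S (trans (shift ext d d∈S′) (trans (cong suc t′d≡0) (sym (at-c ext)))))

    range′ : ∀ d → d ∈ S′ → 1 ≤ t′ d × t′ d ≤ length S′
    range′ d d∈S′ with t′ d in t′d≡ | range d (proj₁ (∈-removeBox⁻ S d∈S′))
    ... | zero  | _ = contradiction t′d≡ (d≢c⇒t′d≢0 d d∈S′)
    ... | suc k | _ , td≤|S| rewrite shift ext d d∈S′ | t′d≡ | |S|≡1+|S′| = s≤s z≤n , s≤s⁻¹ td≤|S|

    injective′ : ∀ d e → d ∈ S′ → e ∈ S′ → t′ d ≡ t′ e → d ≡ e
    injective′ d e d∈S′ e∈S′ t′d≡t′e =
      injective d e (proj₁ (∈-removeBox⁻ S d∈S′)) (proj₁ (∈-removeBox⁻ S e∈S′))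
        (trans (shift ext d d∈S′) (trans (cong suc t′d≡t′e) (sym (shift ext e e∈S′))))

    onto′ : ∀ i → 1 ≤ i → i ≤ length S′ → ∃[ d ] (d ∈ S′ × t′ d ≡ i)
    onto′ i 1≤i i≤|S′| with onto (suc i) (s≤s z≤n) (subst (suc i ≤_) (sym |S|≡1+|S′|) (s≤s i≤|S′|))
    ... | d , d∈S , td≡1+i = d , d∈S′ , suc-injective (trans (sym (shift ext d d∈S′)) td≡1+i)
      where
      d≢c : d ≢ c
      d≢c refl = <⇒≢ 1≤i (sym (suc-injective (trans (sym td≡1+i) (at-c ext))))
      d∈S′ = ∈-removeBox⁺ S d∈S d≢c

extends-tabOf : ∀ {S} c L → Extends S c (tabOf (c ∷ L)) (tabOf L)
extends-tabOf {S} c L = record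
  { at-c  = cong (λ b → if b then 1 else suc (tabOf L c)) (dec-true (c ≟ᵇ c) refl)
  ; shift = λ d d∈S′ → cong (λ b → if b then 1 else suc (tabOf L d))
                           (dec-false (d ≟ᵇ c) (proj₂ (∈-removeBox⁻ S d∈S′)))
  }

extends-pred : ∀ {S c t} → t c ≡ 1 → (∀ d → d ∈ S → 1 ≤ t d) → Extends S c t (pred ∘′ t)
extends-pred {S} tc≡1 positive = record
  { at-c  = tc≡1
  ; shift = λ d d∈S′ → sym (suc-pred _ {{>-nonZero (positive d (proj₁ (∈-removeBox⁻ S d∈S′)))}})
  }

AgreeOn : List Box → (Box → ℕ) → (Box → ℕ) → Set
AgreeOn S t₁ t₂ = ∀ d → d ∈ S → t₁ d ≡ t₂ d

module _ {S c t₁ t₁′ t₂ t₂′} (ext₁ : Extends S c t₁ t₁′) (ext₂ : Extends S c t₂ t₂′) where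

  agreeOn-extend : AgreeOn (removeBox c S) t₁′ t₂′ → AgreeOn S t₁ t₂
  agreeOn-extend agree d d∈S with ∈-removeBox-split {c} S d∈S
  ... | inj₁ refl = trans (at-c ext₁) (sym (at-c ext₂))
  ... | inj₂ d∈S′ = trans (shift ext₁ d d∈S′) (trans (cong suc (agree d d∈S′)) (sym (shift ext₂ d d∈S′)))

  agreeOn-restrict : AgreeOn S t₁ t₂ → AgreeOn (removeBox c S) t₁′ t₂′
  agreeOn-restrict agree d d∈S′ = suc-injective
    (trans (sym (shift ext₁ d d∈S′)) (trans (agree d (proj₁ (∈-removeBox⁻ S d∈S′))) (shift ext₂ d d∈S′)))

isTableau-positive : ∀ {S t} → IsTableau S t → ∀ d → d ∈ S → 1 ≤ t d
isTableau-positive (range , _) d d∈S = proj₁ (range d d∈S)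

filling⇒tableau : ∀ {S θ} L → Unique S → IsFilling S θ L →
                  IsTableau S (tabOf L) × HasType S θ (tabOf L)
filling⇒tableau []      u refl = ((λ _ ()) , (λ _ _ ()) , λ { _ (s≤s z≤n) () }) , λ _ ()
filling⇒tableau (c ∷ L) u ((c∈S , θc≡0 , _) , filling) =
  isTableau-extend u c∈S ext tableau , hasType-extend u c∈S ext (isTableau-positive tableau) θc≡0 typed
  where
  ext = extends-tabOf c L
  IH = filling⇒tableau L (removeBox-unique c u) filling
  tableau = proj₁ IH
  typed = proj₂ IH

filling-unique : ∀ {S θ} L L′ → Unique S → IsFilling S θ L → IsFilling S θ L′ →
                 AgreeOn S (tabOf L) (tabOf L′) → L ≡ L′
filling-unique []      []        u _ _ _ = refl
filling-unique []      (c′ ∷ L′) u refl ((() , _) , _) _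
filling-unique (c ∷ L) []        u ((() , _) , _) refl _
filling-unique {S} (c ∷ L) (c′ ∷ L′) u ((c∈S , _) , fillingL) filling′@((c′∈S , _) , fillingL′) agree
  with injective′ c c′ c∈S c′∈S both-labelled-1
  where
  injective′ = proj₁ (proj₂ (proj₁ (filling⇒tableau (c′ ∷ L′) u filling′)))
  both-labelled-1 : tabOf (c′ ∷ L′) c ≡ tabOf (c′ ∷ L′) c′
  both-labelled-1 = begin
    tabOf (c′ ∷ L′) c   ≡⟨ agree c c∈S ⟨
    tabOf (c ∷ L) c     ≡⟨ at-c (extends-tabOf {S} c L) ⟩
    1                   ≡⟨ at-c (extends-tabOf {S} c′ L′) ⟨
    tabOf (c′ ∷ L′) c′  ∎
    where open ≡-Reasoning
... | refl = cong (c ∷_) (filling-unique L L′ (removeBox-unique c u) fillingL fillingL′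
                           (agreeOn-restrict (extends-tabOf c L) (extends-tabOf c L′) agree))

tableau⇒filling : ∀ n {S θ t} → length S ≡ n → Unique S → IsTableau S t → HasType S θ t →
                  ∃[ L ] (IsFilling S θ L × AgreeOn S (tabOf L) t)
tableau⇒filling _       {[]}                _       _ _ _ = [] , refl , λ _ ()
tableau⇒filling (suc n) {S@(_ ∷ _)} {θ} {t} |S|≡1+n u tableau@(_ , _ , onto) typed =
  c ∷ L , ((c∈S , θc≡0 , hooks-nonzero) , filling) , agreeOn-extend (extends-tabOf c L) ext agree
  where
  lowest = onto 1 (s≤s z≤n) (s≤s z≤n)
  c = proj₁ lowest
  c∈S = proj₁ (proj₂ lowest)
  ext = extends-pred (proj₂ (proj₂ lowest)) (isTableau-positive tableau)
  tableau′ = isTableau-restrict u c∈S ext tableau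
  positive′ = isTableau-positive tableau′
  IH = tableau⇒filling n (suc-injective (trans (sym (length-removeBox S u c∈S)) |S|≡1+n))
         (removeBox-unique c u) tableau′ (hasType-restrict u c∈S ext positive′ typed)
  L = proj₁ IH
  filling = proj₁ (proj₂ IH)
  agree = proj₂ (proj₂ IH)

  θc≡0 : θ c ≡ + 0
  θc≡0 = trans (sym (typed c c∈S)) (typeOf-minimum S t c (extends-minimum ext))

  hooks-nonzero : ∀ d → d ∈ S → d ≢ c → inHook d c ≡ true → θ d ≢ + 0
  hooks-nonzero d d∈S d≢c c∈H[d] θd≡0 =
    typeOf-hook-nonzero u c∈S ext positive′ d (∈-removeBox⁺ S d∈S d≢c) c∈H[d] (trans (typed d d∈S) θd≡0)

mainTheorem4 : (S : List Box) → IsDiagram S → (θ : Box → ℤ) → IsType S θ →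
    ((L : List Box) → IsFilling S θ L → IsTableau S (tabOf L) × HasType S θ (tabOf L))
    × ((L L′ : List Box) → IsFilling S θ L → IsFilling S θ L′ →
    (∀ c → c ∈ S → tabOf L c ≡ tabOf L′ c) → L ≡ L′)
    × ((t : Box → ℕ) → IsTableau S t → HasType S θ t →
    ∃[ L ] (IsFilling S θ L × (∀ c → c ∈ S → tabOf L c ≡ t c)))
mainTheorem4 S (u , _) θ _ =
  (λ L → filling⇒tableau L u) ,
  (λ L L′ → filling-unique L L′ u) ,
  (λ t → tableau⇒filling (length S) refl u)
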